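{- Let $\Gamma$ be a reduced graph with maximum degree three. Then $\Gamma$ admits a partial orientation as a quasi-transitive mixed graph if and only if $\Gamma$ contains no copy of $\Pi$ (as a subgraph) and the graph formed by the set of edges of $\Gamma$ that are not contained in any copy of $K_3$ contains no odd cycle.
   Context: In a graph $\Gamma$ of maximum degree three, a vertex $u$ is removable when $u$ has degree two, and its two neighbours are adjacent, both have degree three, and have exactly one common neighbour; $\Gamma$ is reduced if it has no removable vertex. $\Pi$ is the graph on six vertices consisting of a triangle with a pendant edge attached at each of its three vertices. The graph formed from a set $X$ of edges has as vertices the endpoints of edges in $X$ and edge set $X$. A mixed graph has a vertex set, a set of (undirected) edges and a set of arcs, with at most one edge or arc between any pair of vertices. A partial orientation of a graph is a mixed graph obtained by orienting some of its edges as arcs. A $2$-dipath is a directed path $xyz$ consisting of arcs $x\to y$, $y\to z$; it is induced if $x$ and $z$ are not joined by an edge or arc. A mixed graph $H$ is quasi-transitive when (1) it has no induced $2$-dipath and (2) for every edge $xy$ there is $t$ with $xty$ or $ytx$ a $2$-dipath. -}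

module Defs where

open import Data.Nat using (ℕ; zero; suc; _+_; _≤_)
open import Data.Nat.Properties using ()
open import Data.Fin using (Fin; zero; suc; toℕ; inject₁; fromℕ)
open import Data.Bool using (Bool; true; false; T; _∧_; not; if_then_else_)
open import Data.List using (List; map; allFin)
open import Data.Product using (Σ; ∃; ∃-syntax; _×_; _,_)
open import Data.Sum using (_⊎_)
open import Relation.Nullary using (¬_)
open import Relation.Binary.PropositionalEquality using (_≡_; _≢_)
open import Function.Definitions using (Injective)

record Graph (n : ℕ) : Set where
  field
    adj    : Fin n → Fin n → Bool
    sym    : ∀ x y → adj x y ≡ adj y x
    irrefl : ∀ x → adj x x ≡ false
open Graph public

countTrue : List Bool → ℕ
countTrue List.[] = 0
countTrue (b List.∷ bs) = (if b then 1 else 0) + countTrue bs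

module _ {n : ℕ} (Γ : Graph n) where

  Adj : Fin n → Fin n → Set
  Adj x y = T (adj Γ x y)

  degree : Fin n → ℕ
  degree v = countTrue (map (adj Γ v) (allFin n))

  MaxDegreeAtMost3 : Set
  MaxDegreeAtMost3 = ∀ v → degree v ≤ 3

  commonNeighbours : Fin n → Fin n → ℕ
  commonNeighbours v w = countTrue (map (λ z → adj Γ v z ∧ adj Γ w z) (allFin n))

  Removable : Fin n → Set
  Removable u = degree u ≡ 2 ×
    Σ (Fin n) λ v → Σ (Fin n) λ w →
      v ≢ w × Adj u v × Adj u w × Adj v w ×
      degree v ≡ 3 × degree w ≡ 3 × commonNeighbours v w ≡ 1

  Reduced : Set
  Reduced = ¬ (Σ (Fin n) Removable)

-- The graph Π: triangle 0,1,2 with pendant edges 0-3, 1-4, 2-5.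
PiEdge : Fin 6 → Fin 6 → Set
PiEdge a b = PiE a b ⊎ PiE b a
  where
  PiE : Fin 6 → Fin 6 → Set
  PiE a b = (toℕ a ≡ 0 × toℕ b ≡ 1) ⊎ (toℕ a ≡ 1 × toℕ b ≡ 2) ⊎ (toℕ a ≡ 0 × toℕ b ≡ 2)
          ⊎ (toℕ a ≡ 0 × toℕ b ≡ 3) ⊎ (toℕ a ≡ 1 × toℕ b ≡ 4) ⊎ (toℕ a ≡ 2 × toℕ b ≡ 5)

module _ {n : ℕ} (Γ : Graph n) where

  ContainsPi : Set
  ContainsPi = Σ (Fin 6 → Fin n) λ f →
    Injective _≡_ _≡_ f × (∀ a b → PiEdge a b → Adj Γ (f a) (f b))

  NonTriangleEdge : Fin n → Fin n → Set
  NonTriangleEdge x y = Adj Γ x y × (∀ z → ¬ (Adj Γ x z × Adj Γ y z))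

  -- An odd cycle in the graph formed by the non-triangle edges:
  -- an injective sequence f 0, …, f p of k = p+1 vertices, k odd and k ≥ 3,
  -- with f i, f (i+1) joined by a non-triangle edge for each i < p, and
  -- the closing edge f p, f 0 also a non-triangle edge.
  NonTriangleOddCycle : Set
  NonTriangleOddCycle = Σ ℕ λ m → let p = suc (suc (m + m)) in
    Σ (Fin (suc p) → Fin n) λ f → Injective _≡_ _≡_ f ×
      (∀ (i : Fin p) → NonTriangleEdge (f (inject₁ i)) (f (suc i))) ×
      NonTriangleEdge (f (fromℕ p)) (f zero)

-- Partial orientations: an arc relation on Γ, arcs only on edges, at most
-- one direction per edge; edges with no arc remain undirected edges.
record PartialOrientation {n : ℕ} (Γ : Graph n) : Set where
  field
    arc       : Fin n → Fin n → Bool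
    arc⇒adj   : ∀ x y → T (arc x y) → Adj Γ x y
    antisym   : ∀ x y → T (arc x y) → ¬ T (arc y x)
open PartialOrientation public

module _ {n : ℕ} {Γ : Graph n} (O : PartialOrientation Γ) where

  Arc : Fin n → Fin n → Set
  Arc x y = T (arc O x y)

  UEdge : Fin n → Fin n → Set
  UEdge x y = Adj Γ x y × ¬ Arc x y × ¬ Arc y x

  TwoDipath : Fin n → Fin n → Fin n → Set
  TwoDipath x y z = Arc x y × Arc y z

  -- x and z joined by neither edge nor arc, i.e. not adjacent in Γ
  InducedTwoDipath : Fin n → Fin n → Fin n → Set
  InducedTwoDipath x y z = TwoDipath x y z × ¬ Adj Γ x z

  QuasiTransitive : Set
  QuasiTransitive =
    (∀ x y z → ¬ InducedTwoDipath x y z) ×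
    (∀ x y → UEdge x y → Σ (Fin n) λ t → TwoDipath x t y ⊎ TwoDipath y t x)

AdmitsQTOrientation : {n : ℕ} → Graph n → Set
AdmitsQTOrientation Γ = Σ (PartialOrientation Γ) QuasiTransitive

-- Quasi-transitivity forces every non-triangle edge to be an arc (an undirected edge
-- needs a 2-dipath through a common neighbour), with a source as tail and a sink as head (an arc
-- into the tail or out of the head would give a 2-dipath whose ends must be adjacent, closing a
-- triangle on the edge). Two sources, or two sinks, are never adjacent. Splitting vertices by
-- whether they have an out-arc therefore 2-colours the non-triangle edges, so there is no odd
-- cycle; and in a copy of Π the pendant edges are non-triangle edges by the degree bound, so two
-- of the three triangle vertices would be adjacent sources or adjacent sinks.
--
-- Without odd cycles the non-triangle edges admit a proper 2-colouring (parity of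
-- walks from a canonical root). Put a vertex on a non-triangle edge on level 0 or 3 by its colour,
-- an end of an edge lying in two triangles on level 2, and every other vertex on level 1; order the
-- vertices by level, ties broken by index, and orient every edge upwards, except the edges p s₂ and
-- s₁ q of a diamond ordered p < s₁ < s₂ < q, which stay undirected and are bypassed by the
-- 2-dipaths p s₁ s₂ and s₁ s₂ q. Since Γ is reduced and Π-free, no two vertices of a triangle lie
-- on non-triangle edges, so equally coloured vertices of levels 0 or 3 are nonadjacent; this, with
-- the neighbourhood structure of diamonds under maximum degree three, excludes induced 2-dipaths.

module Submission where

open import Defs
open import Data.Nat using (ℕ)
open import Data.Product using (_×_)
open import Function.Bundles using (_⇔_)
open import Relation.Nullary using (¬_)

open import Data.Bool using (Bool; true; false; T; _∧_; not; if_then_else_)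
open import Data.Bool.Properties using (∧-identityʳ; T-∧)
open import Data.Empty using (⊥; ⊥-elim)
open import Data.Fin as Fin using (Fin; zero; suc; toℕ; inject₁; fromℕ; fromℕ<; #_)
open import Data.Fin.Properties
  using (any?; all?; _≟_; _<?_; <-cmp; pigeonhole; toℕ<n; toℕ-injective; toℕ-inject₁; toℕ-fromℕ; toℕ-fromℕ<)
open import Data.List using ([]; _∷_; map; allFin; tabulate; find)
open import Data.List.Properties using (map-tabulate)
import Data.List.Membership.Propositional as List
import Data.List.Relation.Unary.Any as List
open import Data.List.Membership.Propositional.Properties using (∈-allFin)
open import Data.Maybe using (just)
open import Data.Maybe.Properties using (just-injective)
open import Data.Nat as ℕ using (zero; suc; _+_; _*_; _≤_; _<_; z≤n; s≤s; parity)
open import Data.Nat.Induction using (<-rec)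
open import Data.Nat.Properties as ℕ using ()
open import Data.Parity.Base as ℙ using (Parity; 0ℙ; 1ℙ; _⁻¹)
open import Data.Parity.Properties as ℙ using (p≢p⁻¹; p+p⁻¹≡1ℙ; +-homo-+; suc-homo-⁻¹; ⁻¹-selfInverse)
open import Data.Product using (Σ; ∃₂; ∃-syntax; _,_; proj₁; proj₂)
open import Data.Sum as Sum using (_⊎_; inj₁; inj₂; swap)
open import Data.Vec using (Vec; []; _∷_; lookup)
open import Data.Vec.Membership.Propositional using (_∈_)
import Data.Vec.Membership.DecPropositional as DecMembership
open import Data.Vec.Relation.Unary.All as All using (All; []; _∷_)
open import Data.Vec.Relation.Unary.Any using (here; there)
open import Data.Vec.Relation.Unary.Unique.Propositional using (Unique; []; _∷_)
open import Data.Vec.Relation.Unary.Unique.Propositional.Properties using (lookup-injective)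
open import Function using (_∘_; case_of_; Equivalence; mk⇔)
open import Function.Definitions using (Injective)
open import Relation.Binary using (tri<; tri≈; tri>)
open import Relation.Binary.PropositionalEquality as ≡ using (_≡_; _≢_; refl; cong; cong₂; subst; subst₂; ≢-sym)
open import Relation.Nullary using (Dec; yes; no; does)
open import Relation.Nullary.Decidable
  using ( ⌊_⌋; T?; ¬?; _×-dec_; _⊎-dec_; False; toWitness; fromWitness; toWitnessFalse; decidable-stable
        ; dec-true; dec-false)

countᶠ : ∀ {n} → (Fin n → Bool) → ℕ
countᶠ f = countTrue (tabulate f)

countTrue-allFin : ∀ {n} (f : Fin n → Bool) → countTrue (map f (allFin n)) ≡ countᶠ f
countTrue-allFin f = cong countTrue (map-tabulate (λ x → x) f)

countᶠ-cong : ∀ {n} {f g : Fin n → Bool} → (∀ x → f x ≡ g x) → countᶠ f ≡ countᶠ g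
countᶠ-cong {zero}  f≗g = refl
countᶠ-cong {suc n} f≗g = cong₂ _+_ (cong (λ b → if b then 1 else 0) (f≗g zero)) (countᶠ-cong (f≗g ∘ suc))

countᶠ-none : ∀ {n} {f : Fin n → Bool} → (∀ x → ¬ T (f x)) → countᶠ f ≡ 0
countᶠ-none {zero}          none = refl
countᶠ-none {suc n} {f} none with f zero | none zero
... | false | _   = countᶠ-none (none ∘ suc)
... | true  | ¬f0 = ⊥-elim (¬f0 _)

_∖_ : ∀ {n} → (Fin n → Bool) → Fin n → Fin n → Bool
(f ∖ a) x = f x ∧ not (does (x ≟ a))

countᶠ-remove : ∀ {n} (f : Fin n → Bool) {a} → T (f a) → countᶠ f ≡ suc (countᶠ (f ∖ a))
countᶠ-remove f {zero} fa with f zero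
... | true = cong suc (countᶠ-cong (λ x → ≡.sym (∧-identityʳ (f (suc x)))))
countᶠ-remove f {suc a} fa
  rewrite ∧-identityʳ (f zero) | countᶠ-remove (f ∘ suc) fa = ℕ.+-suc (if f zero then 1 else 0) _

∖-keeps : ∀ {n} (f : Fin n → Bool) {a x} → x ≢ a → T (f x) → T ((f ∖ a) x)
∖-keeps f {a} {x} x≢a fx with x ≟ a
... | yes x≡a = ⊥-elim (x≢a x≡a)
... | no _    rewrite ∧-identityʳ (f x) = fx

∖-drops : ∀ {n} (f : Fin n → Bool) {a x} → T ((f ∖ a) x) → T (f x) × x ≢ a
∖-drops f {a} {x} fx with f x | x ≟ a
... | true | no x≢a = _ , x≢a

∖-keeps-all : ∀ {n k} (f : Fin n → Bool) {a} {xs : Vec (Fin n) k} →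
  All (a ≢_) xs → All (T ∘ f) xs → All (T ∘ (f ∖ a)) xs
∖-keeps-all f a≢xs fxs = All.map (λ (a≢y , fy) → ∖-keeps f (a≢y ∘ ≡.sym) fy) (All.zip (a≢xs , fxs))

length≤countᶠ : ∀ {n k} {f : Fin n → Bool} {xs : Vec (Fin n) k} →
  Unique xs → All (T ∘ f) xs → k ≤ countᶠ f
length≤countᶠ [] [] = z≤n
length≤countᶠ {f = f} (x≢xs ∷ uniq) (fx ∷ fxs) rewrite countᶠ-remove f fx =
  s≤s (length≤countᶠ uniq (∖-keeps-all f x≢xs fxs))

countᶠ≡length : ∀ {n k} {f : Fin n → Bool} {xs : Vec (Fin n) k} →
  Unique xs → All (T ∘ f) xs → (∀ y → T (f y) → y ∈ xs) → countᶠ f ≡ k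
countᶠ≡length [] [] ⊆xs = countᶠ-none (λ y fy → case ⊆xs y fy of λ ())
countᶠ≡length {f = f} {x ∷ xs} (x≢xs ∷ uniq) (fx ∷ fxs) ⊆xs rewrite countᶠ-remove f fx =
  cong suc (countᶠ≡length uniq (∖-keeps-all f x≢xs fxs) ⊆xs′)
  where
  ⊆xs′ : ∀ y → T ((f ∖ x) y) → y ∈ xs
  ⊆xs′ y f∖xy with ∖-drops f f∖xy
  ... | fy , y≢x with ⊆xs y fy
  ...   | here y≡x = ⊥-elim (y≢x y≡x)
  ...   | there y∈xs = y∈xs

∉⇒All≢ : ∀ {a} {A : Set a} {k} {u : A} {xs : Vec A k} → ¬ u ∈ xs → All (u ≢_) xs
∉⇒All≢ {xs = []}     _   = []
∉⇒All≢ {xs = x ∷ xs} u∉ = u∉ ∘ here ∷ ∉⇒All≢ (u∉ ∘ there)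

≢⇒≡⁻¹ : ∀ {p q : Parity} → p ≢ q → q ≡ p ⁻¹
≢⇒≡⁻¹ {0ℙ} {0ℙ} p≢q = ⊥-elim (p≢q refl)
≢⇒≡⁻¹ {0ℙ} {1ℙ} _   = refl
≢⇒≡⁻¹ {1ℙ} {0ℙ} _   = refl
≢⇒≡⁻¹ {1ℙ} {1ℙ} p≢q = ⊥-elim (p≢q refl)

+-⁻¹ : ∀ p q → (p ℙ.+ q) ⁻¹ ≡ p ℙ.+ q ⁻¹
+-⁻¹ 0ℙ q  = refl
+-⁻¹ 1ℙ 0ℙ = refl
+-⁻¹ 1ℙ 1ℙ = refl

+≡1ℙ : ∀ p q → p ℙ.+ q ≡ 1ℙ → p ≡ 1ℙ ⊎ q ≡ 1ℙ
+≡1ℙ 0ℙ q  e = inj₂ e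
+≡1ℙ 1ℙ q  e = inj₁ refl

parity-suc : ∀ k → parity (suc k) ≡ parity k ⁻¹
parity-suc k = ≡.sym (⁻¹-selfInverse (suc-homo-⁻¹ k))

parity-double : ∀ m → parity (m + m) ≡ 0ℙ
parity-double m = ≡.trans (+-homo-+ m m) (ℙ.p+p≡0ℙ (parity m))

parity-pigeonhole : ∀ (p q r : Parity) → p ≡ q ⊎ p ≡ r ⊎ q ≡ r
parity-pigeonhole 0ℙ 0ℙ _  = inj₁ refl
parity-pigeonhole 1ℙ 1ℙ _  = inj₁ refl
parity-pigeonhole 0ℙ 1ℙ 0ℙ = inj₂ (inj₁ refl)
parity-pigeonhole 1ℙ 0ℙ 1ℙ = inj₂ (inj₁ refl)
parity-pigeonhole 0ℙ 1ℙ 1ℙ = inj₂ (inj₂ refl)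
parity-pigeonhole 1ℙ 0ℙ 0ℙ = inj₂ (inj₂ refl)

even-shape : ∀ k → parity k ≡ 0ℙ → k ≡ 0 ⊎ ∃[ m ] k ≡ suc (suc (m + m))
even-shape zero          _ = inj₁ refl
even-shape (suc zero)    ()
even-shape (suc (suc k)) e with even-shape k e
... | inj₁ refl       = inj₂ (0 , refl)
... | inj₂ (m , refl) = inj₂ (suc m , cong (3 +_) (≡.sym (ℕ.+-suc m m)))

-- Odd cycles and 2-colourings

injective⊎collision : ∀ {k n} (f : Fin k → Fin n) →
  Injective _≡_ _≡_ f ⊎ ∃₂ λ i j → i Fin.< j × f i ≡ f j
injective⊎collision f with any? (λ i → any? (λ j → i <? j ×-dec f i ≟ f j))
... | yes (i , j , i<j , fi≡fj) = inj₂ (i , j , i<j , fi≡fj)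
... | no ¬collision = inj₁ injective
  where
  injective : Injective _≡_ _≡_ f
  injective {i} {j} fi≡fj with <-cmp i j
  ... | tri< i<j _ _ = ⊥-elim (¬collision (i , j , i<j , fi≡fj))
  ... | tri≈ _ i≡j _ = i≡j
  ... | tri> _ _ j<i = ⊥-elim (¬collision (j , i , j<i , ≡.sym fi≡fj))

find-cong : ∀ {a p q} {A : Set a} {P : A → Set p} {Q : A → Set q}
  (P? : ∀ x → Dec (P x)) (Q? : ∀ x → Dec (Q x)) → (∀ x → does (P? x) ≡ does (Q? x)) → ∀ xs → find P? xs ≡ find Q? xs
find-cong P? Q? P≗Q []       = refl
find-cong P? Q? P≗Q (x ∷ xs) rewrite P≗Q x with does (Q? x)
... | true  = refl
... | false = find-cong P? Q? P≗Q xs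

find-sound : ∀ {a p} {A : Set a} {P : A → Set p} (P? : ∀ x → Dec (P x)) xs {y} → find P? xs ≡ just y → P y
find-sound P? (x ∷ xs) e with P? x
find-sound P? (x ∷ xs) refl | yes px = px
... | no _ = find-sound P? xs e

find-just : ∀ {a p} {A : Set a} {P : A → Set p} (P? : ∀ x → Dec (P x)) {xs x} →
  x List.∈ xs → P x → ∃[ y ] find P? xs ≡ just y
find-just P? {y ∷ xs} x∈xs px with P? y
... | yes _ = y , refl
find-just P? {y ∷ xs} (List.here refl) px  | no ¬py = ⊥-elim (¬py px)
find-just P? {y ∷ xs} (List.there x∈xs) px | no _   = find-just P? x∈xs px

does-⇔ : ∀ {a b} {A : Set a} {B : Set b} → (A → B) → (B → A) → (a? : Dec A) (b? : Dec B) → does a? ≡ does b?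
does-⇔ A→B B→A a? (yes b) = dec-true a? (B→A b)
does-⇔ A→B B→A a? (no ¬b) = dec-false a? (¬b ∘ A→B)

module Bipartite {n : ℕ} (R : Fin n → Fin n → Set) where

  OddCycle : Set
  OddCycle = Σ ℕ λ m → let p = suc (suc (m + m)) in
    Σ (Fin (suc p) → Fin n) λ f → Injective _≡_ _≡_ f ×
      (∀ (i : Fin p) → R (f (inject₁ i)) (f (suc i))) ×
      R (f (fromℕ p)) (f zero)

  ProperColouring : (Fin n → Parity) → Set
  ProperColouring c = ∀ {x y} → R x y → c x ≢ c y

  colour-along-path : ∀ {c} → ProperColouring c → ∀ q (f : Fin (suc q) → Fin n) →
    (∀ i → R (f (inject₁ i)) (f (suc i))) → c (f (fromℕ q)) ≡ c (f zero) ℙ.+ parity q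
  colour-along-path proper zero    f edges = ≡.sym (ℙ.+-identityʳ _)
  colour-along-path {c} proper (suc q) f edges = begin
    c (f (suc (fromℕ q)))               ≡⟨ ≢⇒≡⁻¹ (proper (edges (fromℕ q))) ⟩
    c (f (inject₁ (fromℕ q))) ⁻¹        ≡⟨ cong _⁻¹ (colour-along-path proper q (f ∘ inject₁) (edges ∘ inject₁)) ⟩
    (c (f zero) ℙ.+ parity q) ⁻¹        ≡⟨ +-⁻¹ (c (f zero)) (parity q) ⟩
    c (f zero) ℙ.+ parity q ⁻¹          ≡⟨ cong (c (f zero) ℙ.+_) (≡.sym (parity-suc q)) ⟩
    c (f zero) ℙ.+ parity (suc q)       ∎
    where open ≡.≡-Reasoning

  proper⇒noOddCycle : ∀ {c} → ProperColouring c → ¬ OddCycle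
  proper⇒noOddCycle {c} proper (m , f , _ , edges , closing) =
    p≢p⁻¹ (c (f zero)) (begin
      c (f zero)                  ≡⟨ ≢⇒≡⁻¹ (proper closing) ⟩
      c (f (fromℕ p)) ⁻¹          ≡⟨ cong _⁻¹ (colour-along-path proper p f edges) ⟩
      (c (f zero) ℙ.+ parity p) ⁻¹ ≡⟨ cong (λ q → (c (f zero) ℙ.+ q) ⁻¹) (parity-double m) ⟩
      (c (f zero) ℙ.+ 0ℙ) ⁻¹      ≡⟨ cong _⁻¹ (ℙ.+-identityʳ _) ⟩
      c (f zero) ⁻¹               ∎)
    where
    open ≡.≡-Reasoning
    p : ℕ
    p = suc (suc (m + m))

  infixr 5 _∷_
  data Walk : ℕ → Fin n → Fin n → Set where
    []  : ∀ {u} → Walk 0 u u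
    _∷_ : ∀ {k u w v} → R u w → Walk k w v → Walk (suc k) u v

  _++_ : ∀ {a b u v w} → Walk a u v → Walk b v w → Walk (a + b) u w
  []      ++ q = q
  (r ∷ p) ++ q = r ∷ (p ++ q)

  _∷ʳ_ : ∀ {k u v w} → Walk k u v → R v w → Walk (suc k) u w
  []      ∷ʳ r = r ∷ []
  (r′ ∷ p) ∷ʳ r = r′ ∷ (p ∷ʳ r)

  -- positions past the end give the last vertex
  _!_ : ∀ {k u v} → Walk k u v → ℕ → Fin n
  _!_ {u = u} []      i       = u
  _!_ {u = u} (_ ∷ _) zero    = u
  (_ ∷ w)           ! suc i = w ! i

  vertices : ∀ {k u v} → Walk k u v → Fin k → Fin n
  vertices w i = w ! toℕ i

  !-zero : ∀ {k u v} (w : Walk k u v) → w ! 0 ≡ u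
  !-zero []      = refl
  !-zero (_ ∷ _) = refl

  !-length : ∀ {k u v} (w : Walk k u v) → w ! k ≡ v
  !-length []      = refl
  !-length (_ ∷ w) = !-length w

  !-edge : ∀ {k u v} (w : Walk k u v) {i} → i < k → R (w ! i) (w ! suc i)
  !-edge (r ∷ w) {zero}  _         = subst (R _) (≡.sym (!-zero w)) r
  !-edge (_ ∷ w) {suc i} (s≤s i<k) = !-edge w i<k

  splitAt : ∀ j {k u v} (w : Walk k u v) → j < k →
    ∃[ m ] j + suc m ≡ k × Walk j u (w ! j) × Walk (suc m) (w ! j) v
  splitAt zero    (r ∷ w) _         = _ , refl , [] , r ∷ w
  splitAt (suc j) (r ∷ w) (s≤s j<k) with splitAt j w j<k
  ... | m , e , p , q = m , cong suc e , r ∷ p , q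

  record LoopRemoval (k : ℕ) (u v : Fin n) : Set where
    constructor loopRemoval
    field
      {shortLength loopLength} : ℕ
      lengths  : suc shortLength + suc loopLength ≡ k
      shortcut : Walk (suc shortLength) u v
      {anchor} : Fin n
      loop     : Walk (suc loopLength) anchor anchor

  removeLoop : ∀ i {j k u v} (w : Walk k u v) → i < j → j < k → w ! i ≡ w ! j → LoopRemoval k u v
  removeLoop (suc i) {suc j} (r ∷ w) (s≤s i<j) (s≤s j<k) wi≡wj
    with loopRemoval e short loop ← removeLoop i w i<j j<k wi≡wj = loopRemoval (cong suc e) (r ∷ short) loop
  removeLoop zero {suc j} {u = u} {v} w _ j<k u≡wj with splitAt (suc j) w j<k
  ... | m , e , p , q = loopRemoval (≡.trans (ℕ.+-comm (suc m) (suc j)) e)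
                          (subst (λ x → Walk (suc m) x v) (≡.sym u≡wj′) q)
                          (subst (Walk (suc j) u) (≡.sym u≡wj′) p)
    where
    u≡wj′ : u ≡ w ! suc j
    u≡wj′ = ≡.trans (≡.sym (!-zero w)) u≡wj

  module TwoColouring (R? : ∀ x y → Dec (R x y)) (R-sym : ∀ {x y} → R x y → R y x) (R-irrefl : ∀ {x} → ¬ R x x) where

    reverse : ∀ {k u v} → Walk k u v → Walk k v u
    reverse []      = []
    reverse (r ∷ w) = reverse w ∷ʳ R-sym r

    shortcut<length : ∀ {k u v} (d : LoopRemoval k u v) → suc (LoopRemoval.shortLength d) < k
    shortcut<length (loopRemoval e _ _) = subst (_ <_) e (ℕ.m<m+n _ ℕ.z<s)

    loop<length : ∀ {k u v} (d : LoopRemoval k u v) → suc (LoopRemoval.loopLength d) < k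
    loop<length (loopRemoval e _ _) = subst (_ <_) e (ℕ.m<n+m _ ℕ.z<s)

    -- a walk longer than n repeats a vertex, whose loop can be cut out
    shorten : ∀ {k u v} → Walk k u v → ∃[ k′ ] k′ ≤ n × Walk k′ u v
    shorten {k} = <-rec Shortenable step k
      where
      Shortenable : ℕ → Set
      Shortenable k = ∀ {u v} → Walk k u v → ∃[ k′ ] k′ ≤ n × Walk k′ u v
      step : ∀ k → (∀ {k′} → k′ < k → Shortenable k′) → Shortenable k
      step k rec w with k ℕ.≤? n
      ... | yes k≤n = k , k≤n , w
      ... | no k≰n with pigeonhole (ℕ.≰⇒> k≰n) (vertices w)
      ...   | i , j , i<j , wi≡wj with d ← removeLoop (toℕ i) w i<j (toℕ<n j) wi≡wj =
        rec (shortcut<length d) (LoopRemoval.shortcut d)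

    Reachable : Fin n → Fin n → Set
    Reachable u v = ∃[ k ] Walk (toℕ {suc n} k) u v

    walk? : ∀ k u v → Dec (Walk k u v)
    walk? zero u v with u ≟ v
    ... | yes refl = yes []
    ... | no u≢v   = no λ { [] → u≢v refl }
    walk? (suc k) u v with any? (λ w → R? u w ×-dec walk? k w v)
    ... | yes (w , r , p) = yes (r ∷ p)
    ... | no ¬step        = no λ { (r ∷ p) → ¬step (_ , r , p) }

    reachable? : ∀ u v → Dec (Reachable u v)
    reachable? u v = any? (λ k → walk? (toℕ k) u v)

    reachable : ∀ {k u v} → Walk k u v → Reachable u v
    reachable w with k , k≤n , w′ ← shorten w =
      fromℕ< (s≤s k≤n) , subst (λ k → Walk k _ _) (≡.sym (toℕ-fromℕ< (s≤s k≤n))) w′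

    reachable-step : ∀ {u a b} → R a b → Reachable u a → Reachable u b
    reachable-step r (_ , w) = reachable (w ∷ʳ r)

    rootSearch : ∀ v → ∃[ r ] find (λ u → reachable? u v) (allFin n) ≡ just r
    rootSearch v = find-just (λ u → reachable? u v) (∈-allFin v) (zero , [])

    root : Fin n → Fin n
    root v = proj₁ (rootSearch v)

    root-reaches : ∀ v → Reachable (root v) v
    root-reaches v = find-sound (λ u → reachable? u v) (allFin n) (proj₂ (rootSearch v))

    root-step : ∀ {a b} → R a b → root a ≡ root b
    root-step {a} {b} r = just-injective (begin
      just (root a)                              ≡⟨ ≡.sym (proj₂ (rootSearch a)) ⟩
      find (λ u → reachable? u a) (allFin n)     ≡⟨ find-cong _ _ same-reach (allFin n) ⟩
      find (λ u → reachable? u b) (allFin n)     ≡⟨ proj₂ (rootSearch b) ⟩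
      just (root b)                              ∎)
      where
      open ≡.≡-Reasoning
      same-reach : ∀ u → does (reachable? u a) ≡ does (reachable? u b)
      same-reach u = does-⇔ (reachable-step r) (reachable-step (R-sym r)) (reachable? u a) (reachable? u b)

    simpleOddCycle : ∀ {p x} (w : Walk (suc p) x x) → Injective _≡_ _≡_ (vertices w) →
      parity (suc p) ≡ 1ℙ → OddCycle
    simpleOddCycle {p} {x} w injective odd
      with even-shape p (≡.trans (≡.sym (suc-homo-⁻¹ p)) (cong _⁻¹ odd))
    simpleOddCycle (r ∷ []) _ _ | inj₁ refl = ⊥-elim (R-irrefl r)
    simpleOddCycle {p} {x} w injective odd | inj₂ (m , refl) = m , vertices w , injective , edges , closing
      where
      edges : ∀ i → R (vertices w (inject₁ i)) (vertices w (suc i))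
      edges i = subst (λ j → R (w ! j) (w ! suc (toℕ i))) (≡.sym (toℕ-inject₁ i))
                  (!-edge w (ℕ.<-trans (toℕ<n i) (ℕ.n<1+n p)))
      closing : R (vertices w (fromℕ p)) (vertices w zero)
      closing = subst₂ R (cong (w !_) (≡.sym (toℕ-fromℕ p))) (≡.trans (!-length w) (≡.sym (!-zero w)))
                  (!-edge w (ℕ.n<1+n p))

    -- one of the two closed walks obtained by removing a loop is again odd
    oddClosedWalk⇒oddCycle : ∀ {k x} → Walk k x x → parity k ≡ 1ℙ → OddCycle
    oddClosedWalk⇒oddCycle {k} = <-rec OddClosed step k
      where
      OddClosed : ℕ → Set
      OddClosed k = ∀ {x} → Walk k x x → parity k ≡ 1ℙ → OddCycle
      step : ∀ k → (∀ {k′} → k′ < k → OddClosed k′) → OddClosed k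
      step zero    rec w ()
      step (suc p) rec w odd with injective⊎collision (vertices w)
      ... | inj₁ injective = simpleOddCycle w injective odd
      ... | inj₂ (i , j , i<j , wi≡wj)
        with d@(loopRemoval {a} {l} e short loop) ← removeLoop (toℕ i) w i<j (toℕ<n j) wi≡wj
        with +≡1ℙ (parity (suc a)) (parity (suc l))
                  (≡.trans (≡.sym (+-homo-+ (suc a) (suc l))) (≡.trans (cong parity e) odd))
      ...   | inj₁ odd-short = rec (shortcut<length d) short odd-short
      ...   | inj₂ odd-loop  = rec (loop<length d) loop odd-loop

    colour : Fin n → Parity
    colour v = parity (toℕ (proj₁ (root-reaches v)))

    noOddCycle⇒proper : ¬ OddCycle → ProperColouring colour
    noOddCycle⇒proper noOdd {a} {b} r same = noOdd (oddClosedWalk⇒oddCycle closed odd)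
      where
      ka kb : ℕ
      ka = toℕ (proj₁ (root-reaches a))
      kb = toℕ (proj₁ (root-reaches b))
      closed : Walk (ka + suc kb) (root a) (root a)
      closed = proj₂ (root-reaches a) ++
               (r ∷ reverse (subst (λ x → Walk kb x b) (≡.sym (root-step r)) (proj₂ (root-reaches b))))
      odd : parity (ka + suc kb) ≡ 1ℙ
      odd = begin
        parity (ka + suc kb)           ≡⟨ +-homo-+ ka (suc kb) ⟩
        parity ka ℙ.+ parity (suc kb)  ≡⟨ cong (parity ka ℙ.+_) (parity-suc kb) ⟩
        parity ka ℙ.+ parity kb ⁻¹     ≡⟨ cong (λ q → parity ka ℙ.+ q ⁻¹) (≡.sym same) ⟩
        parity ka ℙ.+ parity ka ⁻¹     ≡⟨ p+p⁻¹≡1ℙ (parity ka) ⟩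
        1ℙ                             ∎
        where open ≡.≡-Reasoning

-- The graph Π

π₀₁ : PiEdge (# 0) (# 1)
π₀₁ = inj₁ (inj₁ (refl , refl))

π₁₂ : PiEdge (# 1) (# 2)
π₁₂ = inj₁ (inj₂ (inj₁ (refl , refl)))

π₀₂ : PiEdge (# 0) (# 2)
π₀₂ = inj₁ (inj₂ (inj₂ (inj₁ (refl , refl))))

π₀₃ : PiEdge (# 0) (# 3)
π₀₃ = inj₁ (inj₂ (inj₂ (inj₂ (inj₁ (refl , refl)))))

π₁₄ : PiEdge (# 1) (# 4)
π₁₄ = inj₁ (inj₂ (inj₂ (inj₂ (inj₂ (inj₁ (refl , refl))))))

π₂₅ : PiEdge (# 2) (# 5)
π₂₅ = inj₁ (inj₂ (inj₂ (inj₂ (inj₂ (inj₂ (refl , refl))))))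

PiEdge-elim : ∀ {ℓ} (E : Fin 6 → Fin 6 → Set ℓ) → (∀ {a b} → E a b → E b a) →
  E (# 0) (# 1) → E (# 1) (# 2) → E (# 0) (# 2) → E (# 0) (# 3) → E (# 1) (# 4) → E (# 2) (# 5) →
  ∀ a b → PiEdge a b → E a b
PiEdge-elim E E-sym e₀₁ e₁₂ e₀₂ e₀₃ e₁₄ e₂₅ = edge
  where
  at : ∀ {a b} a′ b′ → toℕ a ≡ toℕ a′ → toℕ b ≡ toℕ b′ → E a′ b′ → E a b
  at _ _ a≡a′ b≡b′ = subst₂ E (≡.sym (toℕ-injective a≡a′)) (≡.sym (toℕ-injective b≡b′))
  edge : ∀ a b → PiEdge a b → E a b
  edge a b (inj₁ (inj₁ (a≡ , b≡)))                               = at (# 0) (# 1) a≡ b≡ e₀₁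
  edge a b (inj₁ (inj₂ (inj₁ (a≡ , b≡))))                        = at (# 1) (# 2) a≡ b≡ e₁₂
  edge a b (inj₁ (inj₂ (inj₂ (inj₁ (a≡ , b≡)))))                 = at (# 0) (# 2) a≡ b≡ e₀₂
  edge a b (inj₁ (inj₂ (inj₂ (inj₂ (inj₁ (a≡ , b≡))))))          = at (# 0) (# 3) a≡ b≡ e₀₃
  edge a b (inj₁ (inj₂ (inj₂ (inj₂ (inj₂ (inj₁ (a≡ , b≡)))))))   = at (# 1) (# 4) a≡ b≡ e₁₄
  edge a b (inj₁ (inj₂ (inj₂ (inj₂ (inj₂ (inj₂ (a≡ , b≡)))))))   = at (# 2) (# 5) a≡ b≡ e₂₅
  edge a b (inj₂ (inj₁ (b≡ , a≡)))                               = E-sym (at (# 0) (# 1) b≡ a≡ e₀₁)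
  edge a b (inj₂ (inj₂ (inj₁ (b≡ , a≡))))                        = E-sym (at (# 1) (# 2) b≡ a≡ e₁₂)
  edge a b (inj₂ (inj₂ (inj₂ (inj₁ (b≡ , a≡)))))                 = E-sym (at (# 0) (# 2) b≡ a≡ e₀₂)
  edge a b (inj₂ (inj₂ (inj₂ (inj₂ (inj₁ (b≡ , a≡))))))          = E-sym (at (# 0) (# 3) b≡ a≡ e₀₃)
  edge a b (inj₂ (inj₂ (inj₂ (inj₂ (inj₂ (inj₁ (b≡ , a≡)))))))   = E-sym (at (# 1) (# 4) b≡ a≡ e₁₄)
  edge a b (inj₂ (inj₂ (inj₂ (inj₂ (inj₂ (inj₂ (b≡ , a≡)))))))   = E-sym (at (# 2) (# 5) b≡ a≡ e₂₅)

ρ : Fin 6 → Fin 6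
ρ i = lookup (# 1 ∷ # 2 ∷ # 0 ∷ # 4 ∷ # 5 ∷ # 3 ∷ []) i

ρ-injective : Injective _≡_ _≡_ ρ
ρ-injective {i} {j} ρi≡ρj = ≡.trans (≡.sym (ρ³ i)) (≡.trans (cong (ρ ∘ ρ) ρi≡ρj) (ρ³ j))
  where
  ρ³ : ∀ i → ρ (ρ (ρ i)) ≡ i
  ρ³ zero                                = refl
  ρ³ (suc zero)                          = refl
  ρ³ (suc (suc zero))                    = refl
  ρ³ (suc (suc (suc zero)))              = refl
  ρ³ (suc (suc (suc (suc zero))))        = refl
  ρ³ (suc (suc (suc (suc (suc zero))))) = refl

ρ-PiEdge : ∀ a b → PiEdge a b → PiEdge (ρ a) (ρ b)
ρ-PiEdge = PiEdge-elim (λ a b → PiEdge (ρ a) (ρ b)) swap π₁₂ (swap π₀₂) (swap π₀₁) π₁₄ π₂₅ π₀₃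

-- Neighbourhoods, triangles and diamonds

module GraphProperties {n : ℕ} (Γ : Graph n) where

  adj? : ∀ x y → Dec (Adj Γ x y)
  adj? x y = T? (adj Γ x y)

  Adj-sym : ∀ {x y} → Adj Γ x y → Adj Γ y x
  Adj-sym {x} {y} = subst T (Graph.sym Γ x y)

  Adj-irrefl : ∀ {x} → ¬ Adj Γ x x
  Adj-irrefl {x} = subst T (Graph.irrefl Γ x)

  Adj⇒≢ : ∀ {x y} → Adj Γ x y → x ≢ y
  Adj⇒≢ xy refl = Adj-irrefl xy

  NonTriangleEdge? : ∀ x y → Dec (NonTriangleEdge Γ x y)
  NonTriangleEdge? x y = adj? x y ×-dec all? (λ z → ¬? (adj? x z ×-dec adj? y z))

  NonTriangleEdge-sym : ∀ {x y} → NonTriangleEdge Γ x y → NonTriangleEdge Γ y x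
  NonTriangleEdge-sym (xy , noCommon) = Adj-sym xy , λ z (yz , xz) → noCommon z (xz , yz)

  NonTriangleEdge-irrefl : ∀ {x} → ¬ NonTriangleEdge Γ x x
  NonTriangleEdge-irrefl (xx , _) = Adj-irrefl xx

  OnNonTriangleEdge : Fin n → Set
  OnNonTriangleEdge v = ∃[ u ] NonTriangleEdge Γ v u

  OnNonTriangleEdge? : ∀ v → Dec (OnNonTriangleEdge v)
  OnNonTriangleEdge? v = any? (NonTriangleEdge? v)

  Spine : Fin n → Set
  Spine v = Σ (Fin n) λ u → Σ (Fin n) λ w₁ → Σ (Fin n) λ w₂ →
    Adj Γ v u × w₁ ≢ w₂ × Adj Γ v w₁ × Adj Γ u w₁ × Adj Γ v w₂ × Adj Γ u w₂

  Spine? : ∀ v → Dec (Spine v)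
  Spine? v = any? λ u → any? λ w₁ → any? λ w₂ →
    adj? v u ×-dec ¬? (w₁ ≟ w₂) ×-dec adj? v w₁ ×-dec adj? u w₁ ×-dec adj? v w₂ ×-dec adj? u w₂

  commonNeighbour : ∀ {x y} → Adj Γ x y → ¬ NonTriangleEdge Γ x y → ∃[ t ] Adj Γ x t × Adj Γ y t
  commonNeighbour {x} {y} xy ¬nt with any? (λ t → adj? x t ×-dec adj? y t)
  ... | yes common = common
  ... | no ¬common = ⊥-elim (¬nt (xy , λ t common → ¬common (t , common)))

  degree≡ : ∀ {v k} {xs : Vec (Fin n) k} → Unique xs → All (Adj Γ v) xs →
    (∀ u → Adj Γ v u → u ∈ xs) → degree Γ v ≡ k
  degree≡ {v} uniq adjs complete = ≡.trans (countTrue-allFin (adj Γ v)) (countᶠ≡length uniq adjs complete)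

  neighbour∈ : ∀ {v k u} {xs : Vec (Fin n) k} → degree Γ v ≤ k → Unique xs → All (Adj Γ v) xs →
    Adj Γ v u → u ∈ xs
  neighbour∈ {v} {k} {u} {xs} deg≤k uniq adjs vu with DecMembership._∈?_ (_≟_ {n}) u xs
  ... | yes u∈xs = u∈xs
  ... | no u∉xs = ⊥-elim (ℕ.<-irrefl refl (ℕ.≤-trans k<deg deg≤k))
    where
    k<deg : k ℕ.< degree Γ v
    k<deg = subst (suc k ≤_) (≡.sym (countTrue-allFin (adj Γ v)))
              (length≤countᶠ (∉⇒All≢ u∉xs ∷ uniq) (vu ∷ adjs))

  commonNeighbours≡1 : ∀ {v w t} → Adj Γ v t → Adj Γ w t → (∀ u → Adj Γ v u → Adj Γ w u → u ≡ t) →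
    commonNeighbours Γ v w ≡ 1
  commonNeighbours≡1 {v} {w} vt wt only = ≡.trans (countTrue-allFin (λ z → adj Γ v z ∧ adj Γ w z))
    (countᶠ≡length ([] ∷ []) (Equivalence.from T-∧ (vt , wt) ∷ [])
      (λ u vu∧wu → let (vu , wu) = Equivalence.to T-∧ vu∧wu in here (only u vu wu)))

  Π-from-vertices : ∀ {a b c d e f} → Unique (a ∷ b ∷ c ∷ d ∷ e ∷ f ∷ []) →
    Adj Γ a b → Adj Γ b c → Adj Γ a c → Adj Γ a d → Adj Γ b e → Adj Γ c f → ContainsPi Γ
  Π-from-vertices {a} {b} {c} {d} {e} {f} uniq ab bc ac ad be cf =
    lookup vs , (λ {i} {j} → lookup-injective uniq i j) ,
    PiEdge-elim (λ i j → Adj Γ (lookup vs i) (lookup vs j)) Adj-sym ab bc ac ad be cf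
    where
    vs : Vec (Fin n) 6
    vs = a ∷ b ∷ c ∷ d ∷ e ∷ f ∷ []

  Π-rotate : ContainsPi Γ → ContainsPi Γ
  Π-rotate (f , f-injective , edges) =
    f ∘ ρ , ρ-injective ∘ f-injective , λ a b → edges (ρ a) (ρ b) ∘ ρ-PiEdge a b

  Diamond : Fin n → Fin n → Fin n → Fin n → Set
  Diamond p s₁ s₂ q =
    Adj Γ p s₁ × Adj Γ p s₂ × Adj Γ s₁ s₂ × Adj Γ s₁ q × Adj Γ s₂ q × ¬ Adj Γ p q × p ≢ q

  Diamond? : ∀ p s₁ s₂ q → Dec (Diamond p s₁ s₂ q)
  Diamond? p s₁ s₂ q =
    adj? p s₁ ×-dec adj? p s₂ ×-dec adj? s₁ s₂ ×-dec adj? s₁ q ×-dec adj? s₂ q ×-dec ¬? (adj? p q) ×-dec ¬? (p ≟ q)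

  diamond-swapSpine : ∀ {p s₁ s₂ q} → Diamond p s₁ s₂ q → Diamond p s₂ s₁ q
  diamond-swapSpine (ps₁ , ps₂ , s₁s₂ , s₁q , s₂q , p≁q , p≢q) = ps₂ , ps₁ , Adj-sym s₁s₂ , s₂q , s₁q , p≁q , p≢q

  diamond-swapTips : ∀ {p s₁ s₂ q} → Diamond p s₁ s₂ q → Diamond q s₁ s₂ p
  diamond-swapTips (ps₁ , ps₂ , s₁s₂ , s₁q , s₂q , p≁q , p≢q) =
    Adj-sym s₁q , Adj-sym s₂q , s₁s₂ , Adj-sym ps₁ , Adj-sym ps₂ , p≁q ∘ Adj-sym , ≢-sym p≢q

  module MaxDegree3 (maxDeg : MaxDegreeAtMost3 Γ) where

    neighbours₃ : ∀ {v a b c u} → Adj Γ v a → Adj Γ v b → Adj Γ v c → a ≢ b → a ≢ c → b ≢ c →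
      Adj Γ v u → u ≡ a ⊎ u ≡ b ⊎ u ≡ c
    neighbours₃ {v} va vb vc a≢b a≢c b≢c vu
      with neighbour∈ (maxDeg v) ((a≢b ∷ a≢c ∷ []) ∷ (b≢c ∷ []) ∷ [] ∷ []) (va ∷ vb ∷ vc ∷ []) vu
    ... | here u≡a                 = inj₁ u≡a
    ... | there (here u≡b)         = inj₂ (inj₁ u≡b)
    ... | there (there (here u≡c)) = inj₂ (inj₂ u≡c)

    -- by the degree bound, a triangle vertex of Π has no neighbours outside Π
    Π-pendant-nonTriangle : ((f , _) : ContainsPi Γ) → NonTriangleEdge Γ (f (# 0)) (f (# 3))
    Π-pendant-nonTriangle (f , f-injective , edges) = xp , noCommon
      where
      distinct : ∀ i j {i≢j : False (i ≟ j)} → f i ≢ f j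
      distinct i j {i≢j} = toWitnessFalse i≢j ∘ f-injective
      x y z p q r : Fin n
      x = f (# 0); y = f (# 1); z = f (# 2); p = f (# 3); q = f (# 4); r = f (# 5)
      xy : Adj Γ x y
      xy = edges (# 0) (# 1) π₀₁
      xz : Adj Γ x z
      xz = edges (# 0) (# 2) π₀₂
      yz : Adj Γ y z
      yz = edges (# 1) (# 2) π₁₂
      xp : Adj Γ x p
      xp = edges (# 0) (# 3) π₀₃
      yq : Adj Γ y q
      yq = edges (# 1) (# 4) π₁₄
      zr : Adj Γ z r
      zr = edges (# 2) (# 5) π₂₅
      noCommon : ∀ w → ¬ (Adj Γ x w × Adj Γ p w)
      noCommon w (xw , pw)
        with neighbours₃ xy xz xp (Adj⇒≢ yz) (distinct (# 1) (# 3)) (distinct (# 2) (# 3)) xw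
      ... | inj₁ refl
        with neighbours₃ (Adj-sym xy) yz yq (Adj⇒≢ xz) (distinct (# 0) (# 4)) (distinct (# 2) (# 4)) (Adj-sym pw)
      ...   | inj₁ p≡x        = distinct (# 3) (# 0) p≡x
      ...   | inj₂ (inj₁ p≡z) = distinct (# 3) (# 2) p≡z
      ...   | inj₂ (inj₂ p≡q) = distinct (# 3) (# 4) p≡q
      noCommon w (xw , pw) | inj₂ (inj₁ refl)
        with neighbours₃ (Adj-sym xz) (Adj-sym yz) zr (Adj⇒≢ xy) (distinct (# 0) (# 5)) (distinct (# 1) (# 5)) (Adj-sym pw)
      ...   | inj₁ p≡x        = distinct (# 3) (# 0) p≡x
      ...   | inj₂ (inj₁ p≡y) = distinct (# 3) (# 1) p≡y
      ...   | inj₂ (inj₂ p≡r) = distinct (# 3) (# 5) p≡r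
      noCommon w (xw , pw) | inj₂ (inj₂ refl) = Adj-irrefl pw

    diamond-spine-neighbours : ∀ {p s₁ s₂ q u} → Diamond p s₁ s₂ q → Adj Γ s₁ u → u ≡ p ⊎ u ≡ s₂ ⊎ u ≡ q
    diamond-spine-neighbours (ps₁ , ps₂ , s₁s₂ , s₁q , s₂q , p≁q , p≢q) =
      neighbours₃ (Adj-sym ps₁) s₁s₂ s₁q (Adj⇒≢ ps₂) p≢q (Adj⇒≢ s₂q)

    diamond-tip-spine-common : ∀ {p s₁ s₂ q w} → Diamond p s₁ s₂ q → Adj Γ p w → Adj Γ s₁ w → w ≡ s₂
    diamond-tip-spine-common D@(_ , _ , _ , _ , _ , p≁q , _) pw s₁w with diamond-spine-neighbours D s₁w
    ... | inj₁ refl        = ⊥-elim (Adj-irrefl pw)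
    ... | inj₂ (inj₁ w≡s₂) = w≡s₂
    ... | inj₂ (inj₂ refl) = ⊥-elim (p≁q pw)

    diamond-tip-not-Spine : ∀ {p s₁ s₂ q} → Diamond p s₁ s₂ q → ¬ Spine p
    diamond-tip-not-Spine {s₁ = s₁} {s₂} D@(ps₁ , ps₂ , s₁s₂ , _)
                          (u , w₁ , w₂ , pu , w₁≢w₂ , pw₁ , uw₁ , pw₂ , uw₂)
      with u ≟ s₁ | u ≟ s₂
    ... | yes refl | _ = w₁≢w₂ (≡.trans (diamond-tip-spine-common D pw₁ uw₁)
                                         (≡.sym (diamond-tip-spine-common D pw₂ uw₂)))
    ... | no _ | yes refl = w₁≢w₂ (≡.trans (diamond-tip-spine-common (diamond-swapSpine D) pw₁ uw₁)
                                           (≡.sym (diamond-tip-spine-common (diamond-swapSpine D) pw₂ uw₂)))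
    ... | no u≢s₁ | no u≢s₂ with neighbours₃ ps₁ ps₂ pu (Adj⇒≢ s₁s₂) (≢-sym u≢s₁) (≢-sym u≢s₂) pw₁
    ...   | inj₁ refl        = u≢s₂ (diamond-tip-spine-common D pu (Adj-sym uw₁))
    ...   | inj₂ (inj₁ refl) = u≢s₁ (diamond-tip-spine-common (diamond-swapSpine D) pu (Adj-sym uw₁))
    ...   | inj₂ (inj₂ refl) = Adj-irrefl uw₁

    diamond-spine-Spine : ∀ {p s₁ s₂ q} → Diamond p s₁ s₂ q → Spine s₁
    diamond-spine-Spine (ps₁ , ps₂ , s₁s₂ , s₁q , s₂q , _ , p≢q) =
      _ , _ , _ , s₁s₂ , p≢q , Adj-sym ps₁ , Adj-sym ps₂ , s₁q , s₂q

    diamond-spine-not-OnNonTriangleEdge : ∀ {p s₁ s₂ q} → Diamond p s₁ s₂ q → ¬ OnNonTriangleEdge s₁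
    diamond-spine-not-OnNonTriangleEdge D@(ps₁ , ps₂ , s₁s₂ , s₁q , s₂q , _) (u , s₁u , noCommon)
      with diamond-spine-neighbours D s₁u
    ... | inj₁ refl        = noCommon _ (s₁s₂ , ps₂)
    ... | inj₂ (inj₁ refl) = noCommon _ (Adj-sym ps₁ , Adj-sym ps₂)
    ... | inj₂ (inj₂ refl) = noCommon _ (s₁s₂ , Adj-sym s₂q)

    degree≡3 : ∀ {v a b c} → Adj Γ v a → Adj Γ v b → Adj Γ v c → a ≢ b → a ≢ c → b ≢ c → degree Γ v ≡ 3
    degree≡3 {v} {a} {b} {c} va vb vc a≢b a≢c b≢c = degree≡ uniq adjs (λ u → neighbour∈ (maxDeg v) uniq adjs)
      where
      uniq : Unique (a ∷ b ∷ c ∷ [])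
      uniq = (a≢b ∷ a≢c ∷ []) ∷ (b≢c ∷ []) ∷ [] ∷ []
      adjs : All (Adj Γ v) (a ∷ b ∷ c ∷ [])
      adjs = va ∷ vb ∷ vc ∷ []

    -- the third vertex t either has a third neighbour, giving a copy of Π, or is removable
    ¬triangle-with-two-nonTriangle-vertices : Reduced Γ → ¬ ContainsPi Γ →
      ∀ {y z t x e} → Adj Γ y z → Adj Γ y t → Adj Γ z t → NonTriangleEdge Γ y x → NonTriangleEdge Γ z e → ⊥
    ¬triangle-with-two-nonTriangle-vertices reduced noΠ {y} {z} {t} {x} {e} yz yt zt (yx , x∉△) (ze , e∉△) =
      case any? (λ f → adj? t f ×-dec ¬? (f ≟ y) ×-dec ¬? (f ≟ z)) of λ where
        (yes (f , tf , f≢y , f≢z)) → noΠ (Π-from-vertices (uniq tf f≢y f≢z) yz zt yt yx ze tf)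
        (no noThird) → reduced (t , degree-t noThird , y , z , Adj⇒≢ yz , Adj-sym yt , Adj-sym zt , yz ,
                                degree-y , degree-z , common)
      where
      y≢e : y ≢ e
      y≢e refl = e∉△ t (zt , yt)
      z≢x : z ≢ x
      z≢x refl = x∉△ t (yt , zt)
      t≢x : t ≢ x
      t≢x refl = x∉△ z (yz , Adj-sym zt)
      t≢e : t ≢ e
      t≢e refl = e∉△ y (Adj-sym yz , Adj-sym yt)
      x≢e : x ≢ e
      x≢e refl = x∉△ z (yz , Adj-sym ze)

      uniq : ∀ {f} → Adj Γ t f → f ≢ y → f ≢ z → Unique (y ∷ z ∷ t ∷ x ∷ e ∷ f ∷ [])
      uniq tf f≢y f≢z =
        (Adj⇒≢ yz ∷ Adj⇒≢ yt ∷ Adj⇒≢ yx ∷ y≢e ∷ ≢-sym f≢y ∷ []) ∷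
        (Adj⇒≢ zt ∷ z≢x ∷ Adj⇒≢ ze ∷ ≢-sym f≢z ∷ []) ∷
        (t≢x ∷ t≢e ∷ Adj⇒≢ tf ∷ []) ∷
        (x≢e ∷ (λ { refl → x∉△ t (yt , Adj-sym tf) }) ∷ []) ∷
        ((λ { refl → e∉△ t (zt , Adj-sym tf) }) ∷ []) ∷ [] ∷ []

      degree-t : ¬ (∃[ f ] Adj Γ t f × f ≢ y × f ≢ z) → degree Γ t ≡ 2
      degree-t noThird = degree≡ ((Adj⇒≢ yz ∷ []) ∷ [] ∷ []) (Adj-sym yt ∷ Adj-sym zt ∷ []) only-y-z
        where
        only-y-z : ∀ u → Adj Γ t u → u ∈ y ∷ z ∷ []
        only-y-z u tu with u ≟ y | u ≟ z
        ... | yes u≡y | _       = here u≡y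
        ... | no _    | yes u≡z = there (here u≡z)
        ... | no u≢y  | no u≢z  = ⊥-elim (noThird (u , tu , u≢y , u≢z))

      degree-y : degree Γ y ≡ 3
      degree-y = degree≡3 yx yz yt (≢-sym z≢x) (≢-sym t≢x) (Adj⇒≢ zt)

      degree-z : degree Γ z ≡ 3
      degree-z = degree≡3 ze (Adj-sym yz) zt (≢-sym y≢e) (≢-sym t≢e) (Adj⇒≢ yt)

      common : commonNeighbours Γ y z ≡ 1
      common = commonNeighbours≡1 yt zt only-t
        where
        only-t : ∀ u → Adj Γ y u → Adj Γ z u → u ≡ t
        only-t u yu zu with neighbours₃ yx yz yt (≢-sym z≢x) (≢-sym t≢x) (Adj⇒≢ zt) yu
        ... | inj₁ refl        = ⊥-elim (x∉△ z (yz , Adj-sym zu))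
        ... | inj₂ (inj₁ refl) = ⊥-elim (Adj-irrefl zu)
        ... | inj₂ (inj₂ u≡t)  = u≡t

-- Necessity

module QuasiTransitiveProperties {n : ℕ} {Γ : Graph n} (O : PartialOrientation Γ) (qt : QuasiTransitive O) where
  open GraphProperties Γ

  arc? : ∀ x y → Dec (Arc O x y)
  arc? x y = T? (arc O x y)

  Source Sink : Fin n → Set
  Source v = ∀ u → ¬ Arc O u v
  Sink v = ∀ u → ¬ Arc O v u

  dipath-closes : ∀ {x y z} → Arc O x y → Arc O y z → Adj Γ x z
  dipath-closes {x} {y} {z} xy yz with adj? x z
  ... | yes xz = xz
  ... | no x≁z = ⊥-elim (proj₁ qt x y z ((xy , yz) , x≁z))

  -- an undirected edge would need a 2-dipath through a common neighbour
  nonTriangleEdge-oriented : ∀ {x y} → NonTriangleEdge Γ x y → Arc O x y ⊎ Arc O y x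
  nonTriangleEdge-oriented {x} {y} (xy , noCommon) with arc? x y | arc? y x
  ... | yes x→y | _       = inj₁ x→y
  ... | no _    | yes y→x = inj₂ y→x
  ... | no ¬x→y | no ¬y→x with proj₂ qt x y (xy , ¬x→y , ¬y→x)
  ...   | t , inj₁ (x→t , t→y) = ⊥-elim (noCommon t (arc⇒adj O x t x→t , Adj-sym (arc⇒adj O t y t→y)))
  ...   | t , inj₂ (y→t , t→x) = ⊥-elim (noCommon t (Adj-sym (arc⇒adj O t x t→x) , arc⇒adj O y t y→t))

  nonTriangleEdge-tail-Source : ∀ {x y} → NonTriangleEdge Γ x y → Arc O x y → Source x
  nonTriangleEdge-tail-Source (_ , noCommon) x→y u u→x =
    noCommon u (Adj-sym (arc⇒adj O _ _ u→x) , Adj-sym (dipath-closes u→x x→y))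

  nonTriangleEdge-head-Sink : ∀ {x y} → NonTriangleEdge Γ x y → Arc O x y → Sink y
  nonTriangleEdge-head-Sink (_ , noCommon) x→y u y→u = noCommon u (dipath-closes x→y y→u , arc⇒adj O _ _ y→u)

  Sources-nonadjacent : ∀ {u v} → Source u → Source v → ¬ Adj Γ u v
  Sources-nonadjacent {u} {v} src-u src-v uv with arc? u v | arc? v u
  ... | yes u→v | _       = src-v u u→v
  ... | no _    | yes v→u = src-u v v→u
  ... | no ¬u→v | no ¬v→u with proj₂ qt u v (uv , ¬u→v , ¬v→u)
  ...   | t , inj₁ (_ , t→v) = src-v t t→v
  ...   | t , inj₂ (_ , t→u) = src-u t t→u

  Sinks-nonadjacent : ∀ {u v} → Sink u → Sink v → ¬ Adj Γ u v
  Sinks-nonadjacent {u} {v} snk-u snk-v uv with arc? u v | arc? v u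
  ... | yes u→v | _       = snk-u v u→v
  ... | no _    | yes v→u = snk-v u v→u
  ... | no ¬u→v | no ¬v→u with proj₂ qt u v (uv , ¬u→v , ¬v→u)
  ...   | t , inj₁ (u→t , _) = snk-u t u→t
  ...   | t , inj₂ (v→t , _) = snk-v t v→t

  side : Fin n → Parity
  side v = if does (any? (arc? v)) then 1ℙ else 0ℙ

  nonTriangleEdge-end : ∀ {v w} → NonTriangleEdge Γ v w → (side v ≡ 1ℙ → Source v) × (side v ≡ 0ℙ → Sink v)
  nonTriangleEdge-end {v} nt with any? (arc? v) | nonTriangleEdge-oriented nt
  ... | yes _         | inj₁ v→w = (λ _ → nonTriangleEdge-tail-Source nt v→w) , λ ()
  ... | yes (u , v→u) | inj₂ w→v = ⊥-elim (nonTriangleEdge-head-Sink (NonTriangleEdge-sym nt) w→v u v→u)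
  ... | no noOut      | _        = (λ ()) , λ _ u v→u → noOut (u , v→u)

  same-side-nonadjacent : ∀ {u v p q s} → NonTriangleEdge Γ u p → NonTriangleEdge Γ v q →
    side u ≡ s → side v ≡ s → ¬ Adj Γ u v
  same-side-nonadjacent {s = 1ℙ} ntu ntv u≡s v≡s =
    Sources-nonadjacent (proj₁ (nonTriangleEdge-end ntu) u≡s) (proj₁ (nonTriangleEdge-end ntv) v≡s)
  same-side-nonadjacent {s = 0ℙ} ntu ntv u≡s v≡s =
    Sinks-nonadjacent (proj₂ (nonTriangleEdge-end ntu) u≡s) (proj₂ (nonTriangleEdge-end ntv) v≡s)

  open Bipartite (NonTriangleEdge Γ) using (ProperColouring; proper⇒noOddCycle)

  side-proper : ProperColouring side
  side-proper nt same = same-side-nonadjacent nt (NonTriangleEdge-sym nt) same refl (proj₁ nt)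

  ¬nonTriangleOddCycle : ¬ NonTriangleOddCycle Γ
  ¬nonTriangleOddCycle = proper⇒noOddCycle side-proper

  module _ (maxDeg : MaxDegreeAtMost3 Γ) where
    open MaxDegree3 maxDeg

    -- two of the three triangle vertices of Π lie on the same side
    ¬containsPi : ¬ ContainsPi Γ
    ¬containsPi π@(f , _ , edges) =
      case parity-pigeonhole (side (f (# 0))) (side (f (# 1))) (side (f (# 2))) of λ where
        (inj₁ s₀≡s₁)        → same-side-nonadjacent nt₀ nt₁ s₀≡s₁ refl (edges (# 0) (# 1) π₀₁)
        (inj₂ (inj₁ s₀≡s₂)) → same-side-nonadjacent nt₀ nt₂ s₀≡s₂ refl (edges (# 0) (# 2) π₀₂)
        (inj₂ (inj₂ s₁≡s₂)) → same-side-nonadjacent nt₁ nt₂ s₁≡s₂ refl (edges (# 1) (# 2) π₁₂)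
      where
      nt₀ : NonTriangleEdge Γ (f (# 0)) (f (# 3))
      nt₀ = Π-pendant-nonTriangle π
      nt₁ : NonTriangleEdge Γ (f (# 1)) (f (# 4))
      nt₁ = Π-pendant-nonTriangle (Π-rotate π)
      nt₂ : NonTriangleEdge Γ (f (# 2)) (f (# 5))
      nt₂ = Π-pendant-nonTriangle (Π-rotate (Π-rotate π))

-- Sufficiency

module QuasiTransitiveConstruction {n : ℕ} (Γ : Graph n) (maxDeg : MaxDegreeAtMost3 Γ) (reduced : Reduced Γ)
  (noΠ : ¬ ContainsPi Γ) (col : Fin n → Parity)
  (col-proper : Bipartite.ProperColouring (NonTriangleEdge Γ) col) where

  open GraphProperties Γ
  open MaxDegree3 maxDeg

  adjacent-OnNonTriangleEdge-coloured-apart : ∀ {y z} → Adj Γ y z →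
    OnNonTriangleEdge y → OnNonTriangleEdge z → col y ≢ col z
  adjacent-OnNonTriangleEdge-coloured-apart {y} {z} yz (_ , yx) (_ , ze) with NonTriangleEdge? y z
  ... | yes nt = col-proper nt
  ... | no ¬nt with t , yt , zt ← commonNeighbour yz ¬nt =
    ⊥-elim (¬triangle-with-two-nonTriangle-vertices reduced noΠ yz yt zt yx ze)

  colourLevel : Parity → ℕ
  colourLevel 0ℙ = 0
  colourLevel 1ℙ = 3

  level : Fin n → ℕ
  level v with OnNonTriangleEdge? v | Spine? v
  ... | yes _ | _     = colourLevel (col v)
  ... | no _  | yes _ = 2
  ... | no _  | no _  = 1

  colourLevel≤3 : ∀ c → colourLevel c ≤ 3
  colourLevel≤3 0ℙ = z≤n
  colourLevel≤3 1ℙ = ℕ.≤-refl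

  colourLevel≡0 : ∀ {c} → colourLevel c ≡ 0 → c ≡ 0ℙ
  colourLevel≡0 {0ℙ} _ = refl

  colourLevel≡3 : ∀ {c} → colourLevel c ≡ 3 → c ≡ 1ℙ
  colourLevel≡3 {1ℙ} _ = refl

  colourLevel≢2 : ∀ c → colourLevel c ≢ 2
  colourLevel≢2 0ℙ ()
  colourLevel≢2 1ℙ ()

  level≤3 : ∀ v → level v ≤ 3
  level≤3 v with OnNonTriangleEdge? v | Spine? v
  ... | yes _ | _     = colourLevel≤3 (col v)
  ... | no _  | yes _ = s≤s (s≤s z≤n)
  ... | no _  | no _  = s≤s z≤n

  level-OnNonTriangleEdge : ∀ {v} → OnNonTriangleEdge v → level v ≡ colourLevel (col v)
  level-OnNonTriangleEdge {v} on with OnNonTriangleEdge? v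
  ... | yes _  = refl
  ... | no off = ⊥-elim (off on)

  level-Spine : ∀ {v} → ¬ OnNonTriangleEdge v → Spine v → level v ≡ 2
  level-Spine {v} off spine with OnNonTriangleEdge? v | Spine? v
  ... | yes on | _         = ⊥-elim (off on)
  ... | no _   | yes _     = refl
  ... | no _   | no ¬spine = ⊥-elim (¬spine spine)

  level≡0 : ∀ {v} → level v ≡ 0 → OnNonTriangleEdge v × col v ≡ 0ℙ
  level≡0 {v} e with OnNonTriangleEdge? v | Spine? v
  ... | yes on | _ = on , colourLevel≡0 e
  level≡0 () | no _ | yes _
  level≡0 () | no _ | no _

  level≡3 : ∀ {v} → level v ≡ 3 → OnNonTriangleEdge v × col v ≡ 1ℙ
  level≡3 {v} e with OnNonTriangleEdge? v | Spine? v
  ... | yes on | _ = on , colourLevel≡3 e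
  level≡3 () | no _ | yes _
  level≡3 () | no _ | no _

  level≡2 : ∀ {v} → level v ≡ 2 → Spine v
  level≡2 {v} e with OnNonTriangleEdge? v | Spine? v
  ... | yes _ | _         = ⊥-elim (colourLevel≢2 (col v) e)
  ... | no _  | yes spine = spine
  level≡2 () | no _ | no _

  position : Fin n → ℕ
  position v = level v * n + toℕ v

  _≺_ : Fin n → Fin n → Set
  x ≺ y = position x < position y

  _≺?_ : ∀ x y → Dec (x ≺ y)
  x ≺? y = position x ℕ.<? position y

  ≺-irrefl : ∀ {x} → ¬ x ≺ x
  ≺-irrefl = ℕ.<-irrefl refl

  ≺⇒≢ : ∀ {x y} → x ≺ y → x ≢ y
  ≺⇒≢ x≺y refl = ≺-irrefl x≺y

  level<⇒≺ : ∀ {x y} → level x < level y → x ≺ y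
  level<⇒≺ {x} {y} lt = begin-strict
    level x * n + toℕ x  <⟨ ℕ.+-monoʳ-< (level x * n) (toℕ<n x) ⟩
    level x * n + n      ≡⟨ ℕ.+-comm (level x * n) n ⟩
    suc (level x) * n    ≤⟨ ℕ.*-monoˡ-≤ n lt ⟩
    level y * n          ≤⟨ ℕ.m≤m+n (level y * n) (toℕ y) ⟩
    level y * n + toℕ y  ∎
    where open ℕ.≤-Reasoning

  ≺⇒level≤ : ∀ {x y} → x ≺ y → level x ≤ level y
  ≺⇒level≤ {x} {y} x≺y with level x ℕ.≤? level y
  ... | yes ≤ = ≤
  ... | no ≰  = ⊥-elim (ℕ.<-asym x≺y (level<⇒≺ (ℕ.≰⇒> ≰)))

  position-injective : ∀ {x y} → position x ≡ position y → x ≡ y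
  position-injective {x} {y} eq with ℕ.<-cmp (level x) (level y)
  ... | tri< lt _ _ = ⊥-elim (ℕ.<⇒≢ (level<⇒≺ lt) eq)
  ... | tri> _ _ gt = ⊥-elim (ℕ.<⇒≢ (level<⇒≺ gt) (≡.sym eq))
  ... | tri≈ _ same _ = toℕ-injective (ℕ.+-cancelˡ-≡ (level x * n) (toℕ x) (toℕ y)
                          (≡.trans eq (cong (λ l → l * n + toℕ y) (≡.sym same))))

  ≺-connected : ∀ {x y} → x ≢ y → x ≺ y ⊎ y ≺ x
  ≺-connected {x} {y} x≢y with ℕ.<-cmp (position x) (position y)
  ... | tri< x≺y _ _ = inj₁ x≺y
  ... | tri≈ _ eq _  = ⊥-elim (x≢y (position-injective eq))
  ... | tri> _ _ y≺x = inj₂ y≺x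

  level0-nonadjacent : ∀ {u v} → level u ≡ 0 → level v ≡ 0 → ¬ Adj Γ u v
  level0-nonadjacent lu lv uv with on-u , cu ← level≡0 lu | on-v , cv ← level≡0 lv =
    adjacent-OnNonTriangleEdge-coloured-apart uv on-u on-v (≡.trans cu (≡.sym cv))

  level3-nonadjacent : ∀ {u v} → level u ≡ 3 → level v ≡ 3 → ¬ Adj Γ u v
  level3-nonadjacent lu lv uv with on-u , cu ← level≡3 lu | on-v , cv ← level≡3 lv =
    adjacent-OnNonTriangleEdge-coloured-apart uv on-u on-v (≡.trans cu (≡.sym cv))

  colourLevels-ordered : ∀ {c d} → c ≢ d → colourLevel c ≤ colourLevel d → colourLevel c ≡ 0 × colourLevel d ≡ 3
  colourLevels-ordered {0ℙ} {1ℙ} _   _  = refl , refl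
  colourLevels-ordered {0ℙ} {0ℙ} c≢d _  = ⊥-elim (c≢d refl)
  colourLevels-ordered {1ℙ} {1ℙ} c≢d _  = ⊥-elim (c≢d refl)
  colourLevels-ordered {1ℙ} {0ℙ} _   ()

  nonTriangleEdge-levels : ∀ {x y} → NonTriangleEdge Γ x y → x ≺ y → level x ≡ 0 × level y ≡ 3
  nonTriangleEdge-levels {x} {y} nt x≺y = ≡.trans lx (proj₁ ordered) , ≡.trans ly (proj₂ ordered)
    where
    lx : level x ≡ colourLevel (col x)
    lx = level-OnNonTriangleEdge (y , nt)
    ly : level y ≡ colourLevel (col y)
    ly = level-OnNonTriangleEdge (x , NonTriangleEdge-sym nt)
    ordered : colourLevel (col x) ≡ 0 × colourLevel (col y) ≡ 3
    ordered = colourLevels-ordered (col-proper nt) (subst₂ _≤_ lx ly (≺⇒level≤ x≺y))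

  OrderedDiamond : Fin n → Fin n → Fin n → Fin n → Set
  OrderedDiamond p s₁ s₂ q = Diamond p s₁ s₂ q × p ≺ s₁ × s₁ ≺ s₂ × s₂ ≺ q

  OrderedDiamond? : ∀ p s₁ s₂ q → Dec (OrderedDiamond p s₁ s₂ q)
  OrderedDiamond? p s₁ s₂ q = Diamond? p s₁ s₂ q ×-dec p ≺? s₁ ×-dec s₁ ≺? s₂ ×-dec s₂ ≺? q

  -- edges left undirected, to be bypassed by a 2-dipath along the diamond
  Skipped : Fin n → Fin n → Set
  Skipped x y = (∃₂ λ w d → OrderedDiamond x w y d) ⊎ (∃₂ λ c w → OrderedDiamond c x w y)

  Skipped? : ∀ x y → Dec (Skipped x y)
  Skipped? x y =
    any? (λ w → any? (λ d → OrderedDiamond? x w y d)) ⊎-dec any? (λ c → any? (λ w → OrderedDiamond? c x w y))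

  Oriented : Fin n → Fin n → Set
  Oriented x y = Adj Γ x y × x ≺ y × ¬ Skipped x y

  Oriented? : ∀ x y → Dec (Oriented x y)
  Oriented? x y = adj? x y ×-dec x ≺? y ×-dec ¬? (Skipped? x y)

  -- opaque, so that type checking never unfolds the decision procedure
  opaque
    orientation : PartialOrientation Γ
    orientation = record
      { arc     = λ x y → ⌊ Oriented? x y ⌋
      ; arc⇒adj = λ x y → proj₁ ∘ toWitness {a? = Oriented? x y}
      ; antisym = λ x y x→y y→x → ℕ.<-asym (proj₁ (proj₂ (toWitness {a? = Oriented? x y} x→y)))
                                           (proj₁ (proj₂ (toWitness {a? = Oriented? y x} y→x)))
      }

    Arc⇒Oriented : ∀ {x y} → Arc orientation x y → Oriented x y
    Arc⇒Oriented {x} {y} = toWitness {a? = Oriented? x y}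

    Oriented⇒Arc : ∀ {x y} → Oriented x y → Arc orientation x y
    Oriented⇒Arc {x} {y} = fromWitness {a? = Oriented? x y}

  Skipped⇒between : ∀ {x y} → Skipped x y → ∃[ w ] Adj Γ x w × Adj Γ w y × x ≺ w × w ≺ y
  Skipped⇒between (inj₁ (w , _ , (xw , _ , wy , _) , x≺w , w≺y , _)) = w , xw , wy , x≺w , w≺y
  Skipped⇒between (inj₂ (_ , w , (_ , _ , xw , _ , wy , _) , _ , x≺w , w≺y)) = w , xw , wy , x≺w , w≺y

  -- no neighbour of the spine lies strictly between consecutive vertices of the diamond
  OrderedDiamond-arcs : ∀ {p s₁ s₂ q} → OrderedDiamond p s₁ s₂ q →
    Arc orientation p s₁ × Arc orientation s₁ s₂ × Arc orientation s₂ q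
  OrderedDiamond-arcs {p} {s₁} {s₂} {q} (D@(ps₁ , _ , s₁s₂ , _ , s₂q , _) , p≺s₁ , s₁≺s₂ , s₂≺q) =
    Oriented⇒Arc (ps₁ , p≺s₁ , ¬skip₁) , Oriented⇒Arc (s₁s₂ , s₁≺s₂ , ¬skip₂) , Oriented⇒Arc (s₂q , s₂≺q , ¬skip₃)
    where
    ¬skip₁ : ¬ Skipped p s₁
    ¬skip₁ skip with w , _ , ws₁ , p≺w , w≺s₁ ← Skipped⇒between skip
      with diamond-spine-neighbours D (Adj-sym ws₁)
    ... | inj₁ refl        = ≺-irrefl p≺w
    ... | inj₂ (inj₁ refl) = ℕ.<-asym w≺s₁ s₁≺s₂
    ... | inj₂ (inj₂ refl) = ℕ.<-asym w≺s₁ (ℕ.<-trans s₁≺s₂ s₂≺q)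
    ¬skip₂ : ¬ Skipped s₁ s₂
    ¬skip₂ skip with w , s₁w , _ , s₁≺w , w≺s₂ ← Skipped⇒between skip
      with diamond-spine-neighbours D s₁w
    ... | inj₁ refl        = ℕ.<-asym s₁≺w p≺s₁
    ... | inj₂ (inj₁ refl) = ≺-irrefl w≺s₂
    ... | inj₂ (inj₂ refl) = ℕ.<-asym w≺s₂ s₂≺q
    ¬skip₃ : ¬ Skipped s₂ q
    ¬skip₃ skip with w , s₂w , _ , s₂≺w , w≺q ← Skipped⇒between skip
      with diamond-spine-neighbours (diamond-swapSpine D) s₂w
    ... | inj₁ refl        = ℕ.<-asym s₂≺w (ℕ.<-trans p≺s₁ s₁≺s₂)
    ... | inj₂ (inj₁ refl) = ℕ.<-asym s₂≺w s₁≺s₂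
    ... | inj₂ (inj₂ refl) = ≺-irrefl w≺q

  Skipped⇒dipath : ∀ {x y} → Skipped x y → ∃[ t ] TwoDipath orientation x t y
  Skipped⇒dipath (inj₁ (w , _ , D)) = let (x→w , w→y , _) = OrderedDiamond-arcs D in w , x→w , w→y
  Skipped⇒dipath (inj₂ (_ , w , D)) = let (_ , x→w , w→y) = OrderedDiamond-arcs D in w , x→w , w→y

  unoriented⇒Skipped : ∀ {x y} → Adj Γ x y → x ≺ y → ¬ Arc orientation x y → Skipped x y
  unoriented⇒Skipped {x} {y} xy x≺y ¬x→y =
    decidable-stable (Skipped? x y) (λ ¬skip → ¬x→y (Oriented⇒Arc (xy , x≺y , ¬skip)))

  undirectedEdge-dipath : ∀ {x y} → UEdge orientation x y →
    ∃[ t ] (TwoDipath orientation x t y ⊎ TwoDipath orientation y t x)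
  undirectedEdge-dipath (xy , ¬x→y , ¬y→x) with ≺-connected (Adj⇒≢ xy)
  ... | inj₁ x≺y = let (t , path) = Skipped⇒dipath (unoriented⇒Skipped xy x≺y ¬x→y) in t , inj₁ path
  ... | inj₂ y≺x = let (t , path) = Skipped⇒dipath (unoriented⇒Skipped (Adj-sym xy) y≺x ¬y→x) in t , inj₂ path

  -- x, y, z and their common neighbour t form a diamond with spine yt, whose ends are on level 2
  triangles-Skipped : ∀ {x y z} → Adj Γ x y → Adj Γ y z → ¬ NonTriangleEdge Γ x y → ¬ NonTriangleEdge Γ y z →
    ¬ Adj Γ x z → x ≺ y → y ≺ z → Skipped x y ⊎ Skipped y z
  triangles-Skipped {x} {y} {z} xy yz ¬nt₁ ¬nt₂ x≁z x≺y y≺z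
    with t , xt , yt ← commonNeighbour xy ¬nt₁ | _ , ys , zs ← commonNeighbour yz ¬nt₂ =
    Sum.map skip-xy skip-yz (≺-connected (Adj⇒≢ (Adj-sym yt)))
    where
    x≢z : x ≢ z
    x≢z = ≺⇒≢ (ℕ.<-trans x≺y y≺z)
    zt : Adj Γ z t
    zt with neighbours₃ (Adj-sym xy) yz yt x≢z (Adj⇒≢ xt) (λ { refl → x≁z xt }) ys
    ... | inj₁ refl        = ⊥-elim (x≁z (Adj-sym zs))
    ... | inj₂ (inj₁ refl) = ⊥-elim (Adj-irrefl zs)
    ... | inj₂ (inj₂ refl) = zs
    D : Diamond x y t z
    D = xy , xt , yt , yz , Adj-sym zt , x≁z , x≢z
    spine-level : ∀ {p s₁ s₂ q} → Diamond p s₁ s₂ q → level s₁ ≡ 2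
    spine-level D′ = level-Spine (diamond-spine-not-OnNonTriangleEdge D′) (diamond-spine-Spine D′)
    tip-level : ∀ {p s₁ s₂ q} → Diamond p s₁ s₂ q → level p ≢ 2
    tip-level D′ = diamond-tip-not-Spine D′ ∘ level≡2
    x≺t : x ≺ t
    x≺t = level<⇒≺ (subst (level x <_) (≡.sym (spine-level (diamond-swapSpine D)))
            (ℕ.≤∧≢⇒< (subst (level x ≤_) (spine-level D) (≺⇒level≤ x≺y)) (tip-level D)))
    t≺z : t ≺ z
    t≺z = level<⇒≺ (subst (_< level z) (≡.sym (spine-level (diamond-swapSpine D)))
            (ℕ.≤∧≢⇒< (subst (_≤ level z) (spine-level D) (≺⇒level≤ y≺z)) (tip-level (diamond-swapTips D) ∘ ≡.sym)))
    skip-xy : t ≺ y → Skipped x y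
    skip-xy t≺y = inj₁ (t , z , diamond-swapSpine D , x≺t , t≺y , y≺z)
    skip-yz : y ≺ t → Skipped y z
    skip-yz y≺t = inj₂ (x , t , D , x≺y , y≺t , t≺z)

  no-induced-2-dipath : ∀ {x y z} → Arc orientation x y → Arc orientation y z → ¬ Adj Γ x z → ⊥
  no-induced-2-dipath {x} {y} {z} x→y y→z x≁z
    with xy , x≺y , ¬skip₁ ← Arc⇒Oriented x→y | yz , y≺z , ¬skip₂ ← Arc⇒Oriented y→z
    with NonTriangleEdge? x y | NonTriangleEdge? y z
  ... | yes nt | _ = level3-nonadjacent ly≡3 lz≡3 yz
    where
    ly≡3 : level y ≡ 3
    ly≡3 = proj₂ (nonTriangleEdge-levels nt x≺y)
    lz≡3 : level z ≡ 3
    lz≡3 = ℕ.≤-antisym (level≤3 z) (subst (_≤ level z) ly≡3 (≺⇒level≤ y≺z))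
  ... | no _ | yes nt = level0-nonadjacent lx≡0 ly≡0 xy
    where
    ly≡0 : level y ≡ 0
    ly≡0 = proj₁ (nonTriangleEdge-levels nt y≺z)
    lx≡0 : level x ≡ 0
    lx≡0 = ℕ.n≤0⇒n≡0 (subst (level x ≤_) ly≡0 (≺⇒level≤ x≺y))
  ... | no ¬nt₁ | no ¬nt₂ with triangles-Skipped xy yz ¬nt₁ ¬nt₂ x≁z x≺y y≺z
  ...   | inj₁ skip = ¬skip₁ skip
  ...   | inj₂ skip = ¬skip₂ skip

  orientation-quasiTransitive : QuasiTransitive orientation
  orientation-quasiTransitive =
    (λ x y z ((x→y , y→z) , x≁z) → no-induced-2-dipath x→y y→z x≁z) , λ x y → undirectedEdge-dipath

theorem3p6 : {n : ℕ} (Γ : Graph n) → Reduced Γ → MaxDegreeAtMost3 Γ →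
    (AdmitsQTOrientation Γ ⇔ (¬ ContainsPi Γ × ¬ NonTriangleOddCycle Γ))
theorem3p6 Γ reduced maxDeg = mk⇔ necessary sufficient
  where
  open GraphProperties Γ

  necessary : AdmitsQTOrientation Γ → ¬ ContainsPi Γ × ¬ NonTriangleOddCycle Γ
  necessary (O , qt) = ¬containsPi maxDeg , ¬nonTriangleOddCycle
    where open QuasiTransitiveProperties O qt

  sufficient : ¬ ContainsPi Γ × ¬ NonTriangleOddCycle Γ → AdmitsQTOrientation Γ
  sufficient (noΠ , noOddCycle) = orientation , orientation-quasiTransitive
    where
    open Bipartite.TwoColouring (NonTriangleEdge Γ) NonTriangleEdge? NonTriangleEdge-sym NonTriangleEdge-irrefl
    open QuasiTransitiveConstruction Γ maxDeg reduced noΠ colour (noOddCycle⇒proper noOddCycle)
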